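{- Let $m\ge 2$ and $n\ge 1$ be integers. The critical group of the de Bruijn graph $DB_n(m)$ is \[K(DB_n(m))\cong(\mathbb{Z}_{m^n})^{m-2}\oplus\bigoplus_{i=1}^{n-1}(\mathbb{Z}_{m^i})^{m^{n-1-i}(m-1)^2}.\]
   Context: The de Bruijn graph $DB_n(m)$ is the directed graph whose vertices are the strings of length $n$ over an alphabet of $m$ symbols and whose edges are the strings $s_0s_1\ldots s_n$ of length $n+1$, the edge $s_0\ldots s_n$ going from $s_0\ldots s_{n-1}$ to $s_1\ldots s_n$ (loops allowed). Thus $DB_1(m)$ is the complete directed graph on $m$ vertices with a loop at each vertex, and $DB_{n+1}(m)$ is the directed line graph of $DB_n(m)$. For a finite strongly connected directed graph $G=(V,E)$ with $\mathrm{indeg}(v)=\mathrm{outdeg}(v)$ for all $v$ (Eulerian), let $\mathbb{Z}^V$ be the free abelian group on $V$, set $\Delta_v=\sum_{e\in E:\ s(e)=v}(t(e)-v)$, and for $r\in V$ define $K(G,r)=\mathbb{Z}^V/\langle r,\ \Delta_v : v\in V\setminus\{r\}\rangle$; for Eulerian $G$ these groups are isomorphic for all $r$, and the common group is the critical group $K(G)$. $\mathbb{Z}_k$ denotes the cyclic group of order $k$. -}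

module Defs where

open import Data.Nat as ℕ using (ℕ; zero; suc; _∸_; _^_)
open import Data.Integer as ℤ using (ℤ; +_; _-_)
open import Data.Integer.Divisibility using (_∣_)
open import Data.Fin as Fin using (Fin)
import Data.Fin.Properties as FinP
open import Data.Vec as Vec using (Vec; []; _∷_; init; tail)
import Data.Vec.Properties as VecP
open import Data.List as List using (List; []; _∷_; _++_; replicate; concatMap; map; length; lookup; upTo)
open import Data.Product using (Σ; _×_; _,_)
open import Function.Bundles using (_⇔_)
open import Relation.Nullary using (yes; no)
open import Relation.Binary.PropositionalEquality using (_≡_)

allWords : (m n : ℕ) → List (Vec (Fin m) n)
allWords m zero    = [] ∷ []
allWords m (suc n) = concatMap (λ a → map (a ∷_) (allWords m n)) (List.allFin m)

sumL : {A : Set} → List A → (A → ℤ) → ℤ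
sumL []       f = + 0
sumL (x ∷ xs) f = f x ℤ.+ sumL xs f

Word : ℕ → ℕ → Set
Word m n = Vec (Fin m) n

δ : {m n : ℕ} → Word m n → Word m n → ℤ
δ {m} v w with VecP.≡-dec FinP._≟_ v w
... | yes _ = + 1
... | no  _ = + 0

-- de Bruijn graph DB_n(m): vertices Word m n, edges Word m (suc n),
-- edge e goes from init e (s_0..s_{n-1}) to tail e (s_1..s_n).

src : {m n : ℕ} → Word m (suc n) → Word m n
src = init

tgt : {m n : ℕ} → Word m (suc n) → Word m n
tgt = tail

Δ : (m n : ℕ) → Word m n → (Word m n → ℤ)
Δ m n v w = sumL (allWords m (suc n)) (λ e → δ (src e) v ℤ.* (δ (tgt e) w - δ v w))

-- generators of the subgroup ⟨ r , Δ_v : v ≠ r ⟩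
gen : (m n : ℕ) → Word m n → Word m n → (Word m n → ℤ)
gen m n r v with VecP.≡-dec FinP._≟_ v r
... | yes _ = δ r
... | no  _ = Δ m n v

InRelations : (m n : ℕ) → Word m n → (Word m n → ℤ) → Set
InRelations m n r x =
  Σ (Word m n → ℤ) λ c → ∀ w → x w ≡ sumL (allWords m n) (λ v → c v ℤ.* gen m n r v w)

-- Direct sum of cyclic groups ⊕_j ℤ_{d_j}, elements represented by
-- (Fin (length ds) → ℤ) with componentwise congruence mod d_j.

Elt : List ℕ → Set
Elt ds = Fin (length ds) → ℤ

CongMod : (ds : List ℕ) → Elt ds → Elt ds → Set
CongMod ds y z = ∀ j → (+ lookup ds j) ∣ (y j - z j)

-- K(DB_n(m), r) ≅ ⊕_j ℤ_{d_j}: there is a homomorphism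
-- φ : ℤ^V → ⊕_j ℤ_{d_j} (determined by the images img v of the basis
-- vectors) which is surjective and whose kernel is exactly the subgroup
-- ⟨ r , Δ_v : v ≠ r ⟩ (first isomorphism theorem).
CriticalGroupIso : (m n : ℕ) → Word m n → List ℕ → Set
CriticalGroupIso m n r ds =
  Σ (Word m n → Elt ds) λ img →
    let φ : (Word m n → ℤ) → Elt ds
        φ x j = sumL (allWords m n) (λ v → x v ℤ.* img v j)
    in (∀ (y : Elt ds) → Σ (Word m n → ℤ) λ x → CongMod ds (φ x) y)
     × (∀ (x : Word m n → ℤ) → (CongMod ds (φ x) (λ _ → + 0) ⇔ InRelations m n r x))

deBruijnModuli : ℕ → ℕ → List ℕ
deBruijnModuli m n =
  replicate (m ∸ 2) (m ^ n)
  ++ concatMap (λ k → let i = suc k in replicate (m ^ (n ∸ 1 ∸ i) ℕ.* ((m ∸ 1) ^ 2)) (m ^ i))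
               (upTo (n ∸ 1))

-- Write m = k + 2, n = n′ + 1 and R = ⟨ e_r , Δ_v ⟩ ⊆ ℤ^V.  The vertices
-- 0…0 x_l … x₁ form a rooted "shift tree"; each edge (c , L) of it gives the
-- node vector g (c , L) = e_W − e_P, the difference of its two endpoints.  The
-- explicit Laplacian Δ_v = Σ_a e_{tail(v a)} − m·e_v yields three relations
-- among node vectors (leaf, inner, root), which show that m^{n−|L|}·g (c , L) ∈ R
-- and that every e_v is, modulo R, a combination of the generators (c , []) with
-- c ≥ 2 and (c , a ∷ s) with c, a ≥ 1.  Conversely, for each generator T a
-- functional on words, defined by recursion along the tree, is dual to the
-- generators and maps R into m^{n−|L_T|}·ℤ.  A general recognition lemma
-- (Presentation.recognise) turns these facts into ℤ^V / R ≅ ⊕_T ℤ_{m^{n−|L_T|}},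
-- and counting the generators by depth gives the list deBruijnModuli m n.

module Submission where

open import Defs
open import Data.Nat using (ℕ; _≤_)
open import Data.Nat as ℕ using (zero; suc; _<_; z≤n; s≤s; _∸_; _^_)
import Data.Nat.Properties as ℕP
import Data.Nat.Tactic.RingSolver as ℕRing
open import Data.Integer using (ℤ; +_; _+_; _*_; -_; _-_)
import Data.Integer.Properties as ℤP
open import Data.Integer.Tactic.RingSolver using (solve-∀)
open import Data.Integer.Divisibility.Signed
  using (_∣_; divides; ∣ᵤ⇒∣; ∣⇒∣ᵤ; ∣m∣n⇒∣m+n; ∣m∣n⇒∣m-n; ∣n⇒∣m*n; *-monoʳ-∣; ∣m⇒∣-m)
open import Data.Fin as Fin using (Fin; zero; suc)
import Data.Fin.Properties as FinP
open import Data.Vec as Vec using (Vec; []; _∷_; _∷ʳ_)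
import Data.Vec.Properties as VecP
open import Data.List as List using (List; []; _∷_; _++_; map; concatMap; length; allFin; upTo; cartesianProductWith)
import Data.List.Properties as ListP
open import Data.List.Relation.Unary.All as All using (All; []; _∷_)
open import Data.List.Relation.Unary.AllPairs using ([]; _∷_)
open import Data.List.Relation.Unary.Any using (here; there)
open import Data.List.Relation.Unary.Unique.Propositional using (Unique)
import Data.List.Relation.Unary.Unique.Propositional.Properties as UniqueP
open import Data.List.Membership.Propositional using (_∈_; find; lose)
open import Data.List.Membership.Propositional.Properties
  using (∈-allFin; ∈-cartesianProductWith⁺; ∈-cartesianProductWith⁻; ∈-concatMap⁻; ∈-concatMap⁺; ∈-map⁺; ∈-map⁻; ∈-++⁺ˡ; ∈-++⁺ʳ; ∈-++⁻; ∈-upTo⁺; ∈-upTo⁻)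
open import Data.Product using (Σ; _×_; _,_; proj₁; proj₂)
open import Data.Product.Properties using (≡-dec; ,-injective)
open import Data.Sum using (inj₁; inj₂)
open import Relation.Binary.Definitions using (DecidableEquality)
open import Data.Empty using (⊥)
open import Data.Unit using (⊤; tt)
open import Relation.Nullary using (Dec; yes; no; ¬_; contradiction)
open import Relation.Binary.PropositionalEquality
open import Function using (_∘_)
open import Function.Bundles using (_⇔_; mk⇔)

module _ {A : Set} where

  sum-cong : (xs : List A) {f g : A → ℤ} → (∀ a → f a ≡ g a) → sumL xs f ≡ sumL xs g
  sum-cong []       e = refl
  sum-cong (x ∷ xs) e = cong₂ _+_ (e x) (sum-cong xs e)

  sum-vanish : {xs : List A} {f : A → ℤ} → All (λ a → f a ≡ + 0) xs → sumL xs f ≡ + 0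
  sum-vanish []       = refl
  sum-vanish (e ∷ es) = cong₂ _+_ e (sum-vanish es)

  sum-0 : (xs : List A) → sumL xs (λ _ → + 0) ≡ + 0
  sum-0 []       = refl
  sum-0 (x ∷ xs) = trans (ℤP.+-identityˡ _) (sum-0 xs)

  sum-+ : (xs : List A) (f g : A → ℤ) → sumL xs (λ a → f a + g a) ≡ sumL xs f + sumL xs g
  sum-+ []       f g = refl
  sum-+ (x ∷ xs) f g rewrite sum-+ xs f g = interchange (f x) (g x) (sumL xs f) (sumL xs g)
    where
    interchange : ∀ a b c d → (a + b) + (c + d) ≡ (a + c) + (b + d)
    interchange = solve-∀

  sum-*ˡ : (xs : List A) (c : ℤ) (f : A → ℤ) → sumL xs (λ a → c * f a) ≡ c * sumL xs f
  sum-*ˡ []       c f = sym (ℤP.*-zeroʳ c)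
  sum-*ˡ (x ∷ xs) c f rewrite sum-*ˡ xs c f = sym (ℤP.*-distribˡ-+ c (f x) (sumL xs f))

  sum-*ʳ : (xs : List A) (c : ℤ) (f : A → ℤ) → sumL xs (λ a → f a * c) ≡ sumL xs f * c
  sum-*ʳ []       c f = refl
  sum-*ʳ (x ∷ xs) c f rewrite sum-*ʳ xs c f = sym (ℤP.*-distribʳ-+ c (f x) (sumL xs f))

  sum-neg : (xs : List A) (f : A → ℤ) → sumL xs (λ a → - f a) ≡ - sumL xs f
  sum-neg []       f = refl
  sum-neg (x ∷ xs) f rewrite sum-neg xs f = sym (ℤP.neg-distrib-+ (f x) (sumL xs f))

  sum-− : (xs : List A) (f g : A → ℤ) → sumL xs (λ a → f a - g a) ≡ sumL xs f - sumL xs g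
  sum-− xs f g = trans (sum-+ xs f (λ a → - g a)) (cong (_+_ (sumL xs f)) (sum-neg xs g))

  sum-const : (xs : List A) (c : ℤ) → sumL xs (λ _ → c) ≡ + length xs * c
  sum-const []       c = sym (ℤP.*-zeroˡ c)
  sum-const (x ∷ xs) c rewrite sum-const xs c = sym (ℤP.suc-* (+ length xs) c)

  sum-++ : (xs ys : List A) (f : A → ℤ) → sumL (xs ++ ys) f ≡ sumL xs f + sumL ys f
  sum-++ []       ys f = sym (ℤP.+-identityˡ _)
  sum-++ (x ∷ xs) ys f rewrite sum-++ xs ys f = sym (ℤP.+-assoc (f x) _ _)

  sum-sift : (h : A → ℤ) {b : A} → h b ≡ + 1 → (∀ {x} → ¬ x ≡ b → h x ≡ + 0) →
             (G : A → ℤ) {xs : List A} → Unique xs → b ∈ xs →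
             sumL xs (λ x → h x * G x) ≡ G b
  sum-sift h {b} hb h0 G {b ∷ xs} (b∉xs ∷ _) (here refl) =
    trans (cong₂ _+_ (trans (cong (_* G b) hb) (ℤP.*-identityˡ (G b))) (sum-vanish (All.map off b∉xs)))
          (ℤP.+-identityʳ (G b))
    where
    off : ∀ {x} → ¬ b ≡ x → h x * G x ≡ + 0
    off {x} b≢x = trans (cong (_* G x) (h0 (b≢x ∘ sym))) (ℤP.*-zeroˡ (G x))
  sum-sift h hb h0 G {x ∷ xs} (x∉xs ∷ u) (there b∈xs) =
    trans (cong₂ _+_ (trans (cong (_* G x) (h0 (All.lookup x∉xs b∈xs))) (ℤP.*-zeroˡ (G x)))
                     (sum-sift h hb h0 G u b∈xs))
          (ℤP.+-identityˡ _)

module _ {A B : Set} where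

  sum-map : (xs : List A) (g : A → B) (f : B → ℤ) → sumL (map g xs) f ≡ sumL xs (f ∘ g)
  sum-map []       g f = refl
  sum-map (x ∷ xs) g f = cong (_+_ (f (g x))) (sum-map xs g f)

  sum-concatMap : (xs : List A) (h : A → List B) (f : B → ℤ) →
                  sumL (concatMap h xs) f ≡ sumL xs (λ a → sumL (h a) f)
  sum-concatMap []       h f = refl
  sum-concatMap (x ∷ xs) h f =
    trans (sum-++ (h x) (concatMap h xs) f) (cong (_+_ (sumL (h x) f)) (sum-concatMap xs h f))

  sum-swap : (xs : List A) (ys : List B) (F : A → B → ℤ) →
             sumL xs (λ a → sumL ys (F a)) ≡ sumL ys (λ b → sumL xs (λ a → F a b))
  sum-swap []       ys F = sym (sum-0 ys)
  sum-swap (x ∷ xs) ys F rewrite sum-swap xs ys F = sym (sum-+ ys (F x) (λ b → sumL xs (λ a → F a b)))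

𝟙 : {P : Set} → Dec P → ℤ
𝟙 (yes _) = + 1
𝟙 (no _)  = + 0

𝟙-yes : {P : Set} → P → (d : Dec P) → 𝟙 d ≡ + 1
𝟙-yes p (yes _) = refl
𝟙-yes p (no ¬p) = contradiction p ¬p

𝟙-no : {P : Set} → ¬ P → (d : Dec P) → 𝟙 d ≡ + 0
𝟙-no ¬p (yes p) = contradiction p ¬p
𝟙-no ¬p (no _)  = refl

module _ {A B : Set} (f : A → B) where

  at : (xs : List A) → Fin (length (map f xs)) → A
  at (x ∷ xs) zero    = x
  at (x ∷ xs) (suc i) = at xs i

  lookup-map-at : (xs : List A) (i : Fin (length (map f xs))) → List.lookup (map f xs) i ≡ f (at xs i)
  lookup-map-at (x ∷ xs) zero    = refl
  lookup-map-at (x ∷ xs) (suc i) = lookup-map-at xs i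

  at-∈ : (xs : List A) (i : Fin (length (map f xs))) → at xs i ∈ xs
  at-∈ (x ∷ xs) zero    = here refl
  at-∈ (x ∷ xs) (suc i) = there (at-∈ xs i)

  at-injective : {xs : List A} → Unique xs → (i j : Fin (length (map f xs))) → at xs i ≡ at xs j → i ≡ j
  at-injective {x ∷ xs} (x∉ ∷ u) zero    zero    _ = refl
  at-injective {x ∷ xs} (x∉ ∷ u) zero    (suc j) e = contradiction e (All.lookup x∉ (at-∈ xs j))
  at-injective {x ∷ xs} (x∉ ∷ u) (suc i) zero    e = contradiction (sym e) (All.lookup x∉ (at-∈ xs i))
  at-injective {x ∷ xs} (x∉ ∷ u) (suc i) (suc j) e = cong suc (at-injective u i j e)

  at-index : {xs : List A} {y : A} → y ∈ xs → Σ (Fin (length (map f xs))) λ i → at xs i ≡ y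
  at-index (here refl) = zero , refl
  at-index (there y∈)  = let (i , e) = at-index y∈ in suc i , e

  map-constant : {xs : List A} {y : B} → All (λ x → f x ≡ y) xs → map f xs ≡ List.replicate (length xs) y
  map-constant []       = refl
  map-constant (e ∷ es) = cong₂ _∷_ e (map-constant es)

length-∷ʳ : {A : Set} (L : List A) (c : A) → length (L List.∷ʳ c) ≡ suc (length L)
length-∷ʳ []      c = refl
length-∷ʳ (x ∷ L) c = cong suc (length-∷ʳ L c)

concatMap-unique : {A B : Set} (f : A → List B) {xs : List A} → Unique xs → (∀ a → Unique (f a)) →
                   (∀ {a a′ y} → a ∈ xs → a′ ∈ xs → y ∈ f a → y ∈ f a′ → a ≡ a′) →
                   Unique (concatMap f xs)
concatMap-unique f {[]}     _          _        _   = []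
concatMap-unique f {x ∷ xs} (x∉xs ∷ u) f-unique sep =
  UniqueP.++⁺ (f-unique x) (concatMap-unique f u f-unique (λ a∈ a′∈ → sep (there a∈) (there a′∈))) disjoint
  where
  disjoint : ∀ {y} → ¬ (y ∈ f x × y ∈ concatMap f xs)
  disjoint (y∈fx , y∈rest) =
    let (a , a∈xs , y∈fa) = find (∈-concatMap⁻ f y∈rest)
    in All.lookup x∉xs a∈xs (sep (here refl) (there a∈xs) y∈fx y∈fa)

module _ {A B C : Set} (f : A → B → C) where

  concatMap-map : (xs : List A) (ys : List B) →
                  concatMap (λ a → map (f a) ys) xs ≡ cartesianProductWith f xs ys
  concatMap-map []       ys = refl
  concatMap-map (x ∷ xs) ys = cong (map (f x) ys ++_) (concatMap-map xs ys)

  length-cartesianProductWith : (xs : List A) (ys : List B) →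
                                length (cartesianProductWith f xs ys) ≡ length xs ℕ.* length ys
  length-cartesianProductWith []       ys = refl
  length-cartesianProductWith (x ∷ xs) ys =
    trans (ListP.length-++ (map (f x) ys))
          (cong₂ ℕ._+_ (ListP.length-map (f x) ys) (length-cartesianProductWith xs ys))

length-allFin : (m : ℕ) → length (allFin m) ≡ m
length-allFin m = ListP.length-tabulate (λ i → i)

module _ (m : ℕ) where

  allWords-suc : (n : ℕ) → allWords m (suc n) ≡ cartesianProductWith _∷_ (allFin m) (allWords m n)
  allWords-suc n = concatMap-map _∷_ (allFin m) (allWords m n)

  ∈-allWords : {n : ℕ} (w : Word m n) → w ∈ allWords m n
  ∈-allWords []      = here refl
  ∈-allWords {suc n} (a ∷ w) =
    subst (a ∷ w ∈_) (sym (allWords-suc n))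
          (∈-cartesianProductWith⁺ _∷_ (∈-allFin a) (∈-allWords w))

  allWords-unique : (n : ℕ) → Unique (allWords m n)
  allWords-unique zero    = [] ∷ []
  allWords-unique (suc n) =
    subst Unique (sym (allWords-suc n))
          (UniqueP.cartesianProductWith⁺ _∷_ VecP.∷-injective (UniqueP.allFin⁺ m) (allWords-unique n))

  length-allWords : (n : ℕ) → length (allWords m n) ≡ m ^ n
  length-allWords zero    = refl
  length-allWords (suc n) =
    trans (cong length (allWords-suc n))
          (trans (length-cartesianProductWith _∷_ (allFin m) (allWords m n))
                 (cong₂ ℕ._*_ (length-allFin m) (length-allWords n)))

ℤ^V : ℕ → ℕ → Set
ℤ^V m n = Word m n → ℤ

ΣF : (m : ℕ) → (Fin m → ℤ) → ℤ
ΣF m = sumL (allFin m)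

ΣW : (m n : ℕ) → ℤ^V m n → ℤ
ΣW m n = sumL (allWords m n)

ΣF-suc : (m : ℕ) (f : Fin (suc m) → ℤ) → ΣF (suc m) f ≡ f zero + ΣF m (f ∘ suc)
ΣF-suc m f = cong (_+_ (f zero))
  (trans (cong (λ xs → sumL xs f) (sym (ListP.map-tabulate (λ i → i) suc))) (sum-map (allFin m) suc f))

ΣF-const : (m : ℕ) (c : ℤ) → ΣF m (λ _ → c) ≡ + m * c
ΣF-const m c = trans (sum-const (allFin m) c) (cong (λ l → + l * c) (length-allFin m))

ΣW-cons : (m n : ℕ) (f : ℤ^V m (suc n)) → ΣW m (suc n) f ≡ ΣF m (λ a → ΣW m n (λ w → f (a ∷ w)))
ΣW-cons m n f = trans (sum-concatMap (allFin m) _ f)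
                      (sum-cong (allFin m) (λ a → sum-map (allWords m n) (a ∷_) f))

ΣW-snoc : (m n : ℕ) (f : ℤ^V m (suc n)) → ΣW m (suc n) f ≡ ΣW m n (λ u → ΣF m (λ a → f (u ∷ʳ a)))
ΣW-snoc m zero    f = trans (ΣW-cons m zero f)
                            (trans (sum-cong (allFin m) (λ a → ℤP.+-identityʳ (f (a ∷ []))))
                                   (sym (ℤP.+-identityʳ _)))
ΣW-snoc m (suc n) f =
  trans (ΣW-cons m (suc n) f)
        (trans (sum-cong (allFin m) (λ b → ΣW-snoc m n (λ e → f (b ∷ e))))
               (sym (ΣW-cons m n (λ u → ΣF m (λ a → f (u ∷ʳ a))))))

δ-refl : {m n : ℕ} (v : Word m n) → δ v v ≡ + 1
δ-refl v with VecP.≡-dec FinP._≟_ v v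
... | yes _  = refl
... | no v≢v = contradiction refl v≢v

δ-≢ : {m n : ℕ} {v w : Word m n} → ¬ v ≡ w → δ v w ≡ + 0
δ-≢ {v = v} {w} v≢w with VecP.≡-dec FinP._≟_ v w
... | yes v≡w = contradiction v≡w v≢w
... | no _    = refl

sift-δˡ : (m n : ℕ) (v : Word m n) (G : ℤ^V m n) → ΣW m n (λ w → δ w v * G w) ≡ G v
sift-δˡ m n v G = sum-sift (λ w → δ w v) (δ-refl v) δ-≢ G (allWords-unique m n) (∈-allWords m v)

sift-δʳ : (m n : ℕ) (v : Word m n) (G : ℤ^V m n) → ΣW m n (λ w → δ v w * G w) ≡ G v
sift-δʳ m n v G = sum-sift (δ v) (δ-refl v) (λ w≢v → δ-≢ (w≢v ∘ sym)) G (allWords-unique m n) (∈-allWords m v)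

ΣW-δ : (m n : ℕ) (v : Word m n) → ΣW m n (λ w → δ w v) ≡ + 1
ΣW-δ m n v = trans (sum-cong (allWords m n) (λ w → sym (ℤP.*-identityʳ (δ w v)))) (sift-δˡ m n v (λ _ → + 1))

⟪_∣_⟫ : {m n : ℕ} → ℤ^V m n → ℤ^V m n → ℤ
⟪_∣_⟫ {m} {n} x F = ΣW m n (λ w → x w * F w)

module _ {m n : ℕ} where

  ⟪⟫-cong : {x y : ℤ^V m n} (F : ℤ^V m n) → (∀ w → x w ≡ y w) → ⟪ x ∣ F ⟫ ≡ ⟪ y ∣ F ⟫
  ⟪⟫-cong F e = sum-cong (allWords m n) (λ w → cong (_* F w) (e w))

  ⟪⟫-* : (c : ℤ) (x F : ℤ^V m n) → ⟪ (λ w → c * x w) ∣ F ⟫ ≡ c * ⟪ x ∣ F ⟫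
  ⟪⟫-* c x F = trans (sum-cong (allWords m n) (λ w → ℤP.*-assoc c (x w) (F w)))
                     (sum-*ˡ (allWords m n) c _)

  ⟪⟫-− : (x y F : ℤ^V m n) → ⟪ (λ w → x w - y w) ∣ F ⟫ ≡ ⟪ x ∣ F ⟫ - ⟪ y ∣ F ⟫
  ⟪⟫-− x y F =
    trans (sum-cong (allWords m n) (λ w → trans (ℤP.*-distribʳ-+ (F w) (x w) (- y w))
                                               (cong (_+_ (x w * F w)) (sym (ℤP.neg-distribˡ-* (y w) (F w))))))
          (sum-− (allWords m n) _ _)

  ⟪⟫-sum : {A : Set} (xs : List A) (X : A → ℤ^V m n) (F : ℤ^V m n) →
           ⟪ (λ w → sumL xs (λ a → X a w)) ∣ F ⟫ ≡ sumL xs (λ a → ⟪ X a ∣ F ⟫)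
  ⟪⟫-sum xs X F = trans (sum-cong (allWords m n) (λ w → sym (sum-*ʳ xs (F w) (λ a → X a w))))
                        (sum-swap (allWords m n) xs (λ w a → X a w * F w))

  ⟪⟫-δ : (u : Word m n) (F : ℤ^V m n) → ⟪ δ u ∣ F ⟫ ≡ F u
  ⟪⟫-δ u F = sift-δʳ m n u F

-- Δ_v = Σ_a e_{tail(v a)} − m·e_v: the m out-edges of v are v a ↦ tail(v a)
Δ-formula : (m n : ℕ) (v w : Word m n) →
            Δ m n v w ≡ ΣF m (λ a → δ (Vec.tail (v ∷ʳ a)) w) - + m * δ v w
Δ-formula m n v w =
  begin
    ΣW m (suc n) (λ e → δ (Vec.init e) v * (δ (Vec.tail e) w - δ v w))
  ≡⟨ ΣW-snoc m n _ ⟩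
    ΣW m n (λ u → ΣF m (λ a → δ (Vec.init (u ∷ʳ a)) v * (δ (Vec.tail (u ∷ʳ a)) w - δ v w)))
  ≡⟨ sum-cong (allWords m n) (λ u →
       trans (sum-cong (allFin m) (λ a → cong (λ z → δ z v * edge u a) (VecP.init-∷ʳ a u)))
             (sum-*ˡ (allFin m) (δ u v) (edge u))) ⟩
    ΣW m n (λ u → δ u v * ΣF m (λ a → δ (Vec.tail (u ∷ʳ a)) w - δ v w))
  ≡⟨ sift-δˡ m n v _ ⟩
    ΣF m (λ a → δ (Vec.tail (v ∷ʳ a)) w - δ v w)
  ≡⟨ trans (sum-− (allFin m) (λ a → δ (Vec.tail (v ∷ʳ a)) w) (λ _ → δ v w))
           (cong (_-_ (ΣF m (λ a → δ (Vec.tail (v ∷ʳ a)) w))) (ΣF-const m (δ v w))) ⟩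
    ΣF m (λ a → δ (Vec.tail (v ∷ʳ a)) w) - + m * δ v w
  ∎
  where
  open ≡-Reasoning
  edge : Word m n → Fin m → ℤ
  edge u a = δ (Vec.tail (u ∷ʳ a)) w - δ v w

Δ-pairing : (m n : ℕ) (v : Word m n) (F : ℤ^V m n) →
            ⟪ Δ m n v ∣ F ⟫ ≡ ΣF m (λ a → F (Vec.tail (v ∷ʳ a))) - + m * F v
Δ-pairing m n v F =
  begin
    ⟪ Δ m n v ∣ F ⟫
  ≡⟨ ⟪⟫-cong F (Δ-formula m n v) ⟩
    ⟪ (λ w → ΣF m (λ a → δ (Vec.tail (v ∷ʳ a)) w) - + m * δ v w) ∣ F ⟫
  ≡⟨ ⟪⟫-− (λ w → ΣF m (λ a → δ (Vec.tail (v ∷ʳ a)) w)) (λ w → + m * δ v w) F ⟩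
    ⟪ (λ w → ΣF m (λ a → δ (Vec.tail (v ∷ʳ a)) w)) ∣ F ⟫ - ⟪ (λ w → + m * δ v w) ∣ F ⟫
  ≡⟨ cong₂ _-_ (trans (⟪⟫-sum (allFin m) (λ a → δ (Vec.tail (v ∷ʳ a))) F)
                      (sum-cong (allFin m) (λ a → ⟪⟫-δ (Vec.tail (v ∷ʳ a)) F)))
               (trans (⟪⟫-* (+ m) (δ v) F) (cong (+ m *_) (⟪⟫-δ v F))) ⟩
    ΣF m (λ a → F (Vec.tail (v ∷ʳ a))) - + m * F v
  ∎
  where open ≡-Reasoning

-- DB_{n+1}(m) is Eulerian (every in-degree is m), so the columns of the Laplacian sum to 0
Δ-column-sum : (m n : ℕ) (w : Word m (suc n)) → ΣW m (suc n) (λ v → Δ m (suc n) v w) ≡ + 0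
Δ-column-sum m n w =
  begin
    ΣW m (suc n) (λ v → Δ m (suc n) v w)
  ≡⟨ trans (sum-cong (allWords m (suc n)) (λ v → Δ-formula m (suc n) v w)) (sum-− (allWords m (suc n)) _ _) ⟩
    ΣW m (suc n) (λ v → ΣF m (λ a → δ (Vec.tail (v ∷ʳ a)) w)) - ΣW m (suc n) (λ v → + m * δ v w)
  ≡⟨ cong₂ _-_ in-degree (trans (sum-*ˡ (allWords m (suc n)) (+ m) _) (cong (+ m *_) (ΣW-δ m (suc n) w))) ⟩
    + m * + 1 - + m * + 1
  ≡⟨ ℤP.+-inverseʳ (+ m * + 1) ⟩
    + 0
  ∎
  where
  open ≡-Reasoning
  -- the edges into w are (b u) a ↦ u a with u a ≡ w, one for each letter b
  in-degree : ΣW m (suc n) (λ v → ΣF m (λ a → δ (Vec.tail (v ∷ʳ a)) w)) ≡ + m * + 1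
  in-degree = trans (ΣW-cons m n _)
              (trans (sum-cong (allFin m) (λ b → trans (sym (ΣW-snoc m n (λ e → δ e w))) (ΣW-δ m (suc n) w)))
                     (ΣF-const m (+ 1)))

module Relations {m n : ℕ} (r : Word m n) where

  R : ℤ^V m n → Set
  R = InRelations m n r

  R-cong : {x y : ℤ^V m n} → (∀ w → x w ≡ y w) → R x → R y
  R-cong x≗y (c , x≡) = c , λ w → trans (sym (x≗y w)) (x≡ w)

  R-0 : R (λ _ → + 0)
  R-0 = (λ _ → + 0) , λ w →
    sym (trans (sum-cong (allWords m n) (λ v → ℤP.*-zeroˡ (gen m n r v w))) (sum-0 (allWords m n)))

  R-+ : {x y : ℤ^V m n} → R x → R y → R (λ w → x w + y w)
  R-+ (c , x≡) (c′ , y≡) = (λ v → c v + c′ v) , λ w →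
    trans (cong₂ _+_ (x≡ w) (y≡ w))
          (trans (sym (sum-+ (allWords m n) (λ v → c v * gen m n r v w) (λ v → c′ v * gen m n r v w)))
                 (sum-cong (allWords m n) (λ v → sym (ℤP.*-distribʳ-+ (gen m n r v w) (c v) (c′ v)))))

  R-* : (a : ℤ) {x : ℤ^V m n} → R x → R (λ w → a * x w)
  R-* a (c , x≡) = (λ v → a * c v) , λ w →
    trans (cong (a *_) (x≡ w))
          (trans (sym (sum-*ˡ (allWords m n) a (λ v → c v * gen m n r v w)))
                 (sum-cong (allWords m n) (λ v → sym (ℤP.*-assoc a (c v) (gen m n r v w)))))

  R-− : {x y : ℤ^V m n} → R x → R y → R (λ w → x w - y w)
  R-− Rx Ry = R-+ Rx (R-cong (λ w → ℤP.-1*i≡-i _) (R-* (- + 1) Ry))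

  R-sum : {A : Set} (xs : List A) (X : A → ℤ^V m n) → (∀ a → R (X a)) → R (λ w → sumL xs (λ a → X a w))
  R-sum []       X RX = R-0
  R-sum (a ∷ xs) X RX = R-+ (RX a) (R-sum xs X RX)

  gen-r : gen m n r r ≡ δ r
  gen-r with VecP.≡-dec FinP._≟_ r r
  ... | yes _  = refl
  ... | no r≢r = contradiction refl r≢r

  R-r : R (δ r)
  R-r = (λ v → δ v r) , λ w → sym (trans (sift-δˡ m n r (λ v → gen m n r v w)) (cong (λ x → x w) gen-r))

-- Every Δ_v lies in R, including Δ_r = − Σ_{v ≠ r} Δ_v (by Δ-column-sum).
R-Δ : {m n : ℕ} (r v : Word m (suc n)) → Relations.R r (Δ m (suc n) v)
R-Δ {m} {n} r v = (λ u → δ u v - δ r v) , λ w → sym (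
  begin
    ΣW m (suc n) (λ u → (δ u v - δ r v) * gen m (suc n) r u w)
  ≡⟨ sum-cong (allWords m (suc n)) (λ u → gen-away-from-r u w) ⟩
    ΣW m (suc n) (λ u → (δ u v - δ r v) * Δ m (suc n) u w)
  ≡⟨ trans (sum-cong (allWords m (suc n)) (λ u → ℤP.*-distribʳ-+ (Δ m (suc n) u w) (δ u v) (- δ r v)))
           (sum-+ (allWords m (suc n)) _ _) ⟩
    ΣW m (suc n) (λ u → δ u v * Δ m (suc n) u w) + ΣW m (suc n) (λ u → - δ r v * Δ m (suc n) u w)
  ≡⟨ cong₂ _+_ (sift-δˡ m (suc n) v (λ u → Δ m (suc n) u w))
               (trans (sum-*ˡ (allWords m (suc n)) (- δ r v) (λ u → Δ m (suc n) u w))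
                      (trans (cong (- δ r v *_) (Δ-column-sum m n w)) (ℤP.*-zeroʳ (- δ r v)))) ⟩
    Δ m (suc n) v w + + 0
  ≡⟨ ℤP.+-identityʳ _ ⟩
    Δ m (suc n) v w
  ∎)
  where
  open ≡-Reasoning
  -- the coefficient of the generator e_r vanishes, so all generators may be read as Δ_u
  gen-away-from-r : ∀ u w → (δ u v - δ r v) * gen m (suc n) r u w ≡ (δ u v - δ r v) * Δ m (suc n) u w
  gen-away-from-r u w with VecP.≡-dec FinP._≟_ u r
  ... | yes refl rewrite ℤP.+-inverseʳ (δ r v) = trans (ℤP.*-zeroˡ (δ r w)) (sym (ℤP.*-zeroˡ (Δ m (suc n) r w)))
  ... | no _     = refl

∣-zero : (d : ℤ) → d ∣ + 0
∣-zero d = divides (+ 0) (sym (ℤP.*-zeroˡ d))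

∣-sum : {A : Set} {d : ℤ} (xs : List A) (f : A → ℤ) → (∀ a → d ∣ f a) → d ∣ sumL xs f
∣-sum []       f d∣f = ∣-zero _
∣-sum (x ∷ xs) f d∣f = ∣m∣n⇒∣m+n (d∣f x) (∣-sum xs f d∣f)

module Presentation {m n : ℕ} (r : Word m n) (ds : List ℕ) (g : Fin (length ds) → ℤ^V m n) where
  open Relations r

  d : Fin (length ds) → ℤ
  d j = + List.lookup ds j

  ψ : Elt ds → ℤ^V m n
  ψ a w = ΣF (length ds) (λ j → a j * g j w)

  Spanned : ℤ^V m n → Set
  Spanned x = Σ (Elt ds) λ a → R (λ w → x w - ψ a w)

  Spanned-cong : {x y : ℤ^V m n} → (∀ w → x w ≡ y w) → Spanned x → Spanned y
  Spanned-cong x≗y (a , Rx-ψa) = a , R-cong (λ w → cong (_- ψ a w) (x≗y w)) Rx-ψa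

  Spanned-R : {x : ℤ^V m n} → R x → Spanned x
  Spanned-R {x} Rx = (λ _ → + 0) , R-cong (λ w → sym (trans (cong (_-_ (x w)) (ψ0 {w})) (ℤP.+-identityʳ (x w)))) Rx
    where
    ψ0 : ∀ {w} → ψ (λ _ → + 0) w ≡ + 0
    ψ0 {w} = trans (sum-cong (allFin (length ds)) (λ j → ℤP.*-zeroˡ (g j w))) (sum-0 (allFin (length ds)))

  Spanned-g : (j : Fin (length ds)) → Spanned (g j)
  Spanned-g j = (λ i → 𝟙 (i Fin.≟ j)) , R-cong (λ w → sym (trans (cong (_-_ (g j w)) (ψ-basis w)) (ℤP.+-inverseʳ (g j w)))) R-0
    where
    ψ-basis : ∀ w → ψ (λ i → 𝟙 (i Fin.≟ j)) w ≡ g j w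
    ψ-basis w = sum-sift (λ i → 𝟙 (i Fin.≟ j)) (𝟙-yes refl (j Fin.≟ j)) (λ i≢j → 𝟙-no i≢j _)
                         (λ i → g i w) (UniqueP.allFin⁺ (length ds)) (∈-allFin j)

  Spanned-+ : {x y : ℤ^V m n} → Spanned x → Spanned y → Spanned (λ w → x w + y w)
  Spanned-+ {x} {y} (a , Rx) (b , Ry) = (λ j → a j + b j) , R-cong rearrange (R-+ Rx Ry)
    where
    ψ-+ : ∀ w → ψ (λ j → a j + b j) w ≡ ψ a w + ψ b w
    ψ-+ w = trans (sum-cong (allFin (length ds)) (λ j → ℤP.*-distribʳ-+ (g j w) (a j) (b j)))
                  (sum-+ (allFin (length ds)) _ _)
    shuffle : ∀ x y p q → (x - p) + (y - q) ≡ (x + y) - (p + q)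
    shuffle = solve-∀
    rearrange : ∀ w → (x w - ψ a w) + (y w - ψ b w) ≡ (x w + y w) - ψ (λ j → a j + b j) w
    rearrange w = trans (shuffle (x w) (y w) (ψ a w) (ψ b w)) (cong (_-_ (x w + y w)) (sym (ψ-+ w)))

  Spanned-* : (c : ℤ) {x : ℤ^V m n} → Spanned x → Spanned (λ w → c * x w)
  Spanned-* c {x} (a , Rx) = (λ j → c * a j) , R-cong rearrange (R-* c Rx)
    where
    ψ-* : ∀ w → ψ (λ j → c * a j) w ≡ c * ψ a w
    ψ-* w = trans (sum-cong (allFin (length ds)) (λ j → ℤP.*-assoc c (a j) (g j w)))
                  (sum-*ˡ (allFin (length ds)) c _)
    rearrange : ∀ w → c * (x w - ψ a w) ≡ c * x w - ψ (λ j → c * a j) w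
    rearrange w = trans (ℤP.*-distribˡ-+ c (x w) (- ψ a w))
                        (cong (_+_ (c * x w)) (trans (sym (ℤP.neg-distribʳ-* c (ψ a w))) (cong -_ (sym (ψ-* w)))))

  Spanned-− : {x y : ℤ^V m n} → Spanned x → Spanned y → Spanned (λ w → x w - y w)
  Spanned-− {x} {y} Sx Sy = Spanned-+ {x} {λ w → - y w} Sx (Spanned-cong (λ w → ℤP.-1*i≡-i (y w)) (Spanned-* (- + 1) {y} Sy))

  Spanned-sum : {A : Set} (xs : List A) (X : A → ℤ^V m n) →
                (∀ a → Spanned (X a)) → Spanned (λ w → sumL xs (λ a → X a w))
  Spanned-sum []       X SX = Spanned-R R-0
  Spanned-sum (a ∷ xs) X SX = Spanned-+ {X a} {λ w → sumL xs (λ b → X b w)} (SX a) (Spanned-sum xs X SX)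

  Spanned-all : (∀ v → Spanned (δ v)) → ∀ x → Spanned x
  Spanned-all Sδ x =
    Spanned-cong (λ w → trans (sum-cong (allWords m n) (λ v → ℤP.*-comm (x v) (δ v w))) (sift-δˡ m n w x))
                 (Spanned-sum (allWords m n) (λ v w → x v * δ v w) (λ v → Spanned-* (x v) (Sδ v)))

  -- img w i is the value φ_i(e_w); the hypotheses are duality, the orders
  -- d_j·g_j ∈ R, φ_i(generators of R) ⊆ d_i·ℤ, and spanning
  recognise : (img : Word m n → Elt ds) →
              (∀ i j → ⟪ g j ∣ (λ w → img w i) ⟫ ≡ 𝟙 (j Fin.≟ i)) →
              (∀ j → R (λ w → d j * g j w)) →
              (∀ v i → d i ∣ ⟪ gen m n r v ∣ (λ w → img w i) ⟫) →
              (∀ v → Spanned (δ v)) →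
              CriticalGroupIso m n r ds
  recognise img dual order kills spans = img , surjective , kernel
    where
    φ : ℤ^V m n → Elt ds
    φ x i = ⟪ x ∣ (λ w → img w i) ⟫

    φψ : ∀ a i → φ (ψ a) i ≡ a i
    φψ a i =
      trans (⟪⟫-sum (allFin (length ds)) (λ j w → a j * g j w) (λ w → img w i))
      (trans (sum-cong (allFin (length ds)) (λ j →
                trans (⟪⟫-* (a j) (g j) (λ w → img w i))
                      (trans (cong (a j *_) (dual i j)) (ℤP.*-comm (a j) _))))
             (sum-sift (λ j → 𝟙 (j Fin.≟ i)) (𝟙-yes refl (i Fin.≟ i)) (λ j≢i → 𝟙-no j≢i _)
                       a (UniqueP.allFin⁺ (length ds)) (∈-allFin i)))

    φ-R : ∀ {x} → R x → ∀ i → d i ∣ φ x i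
    φ-R {x} (c , x≡) i =
      subst (d i ∣_)
            (sym (trans (⟪⟫-cong (λ w → img w i) x≡)
                        (trans (⟪⟫-sum (allWords m n) (λ v w → c v * gen m n r v w) (λ w → img w i))
                               (sum-cong (allWords m n) (λ v → ⟪⟫-* (c v) (gen m n r v) (λ w → img w i))))))
            (∣-sum (allWords m n) _ (λ v → ∣n⇒∣m*n (c v) (kills v i)))

    ψ-R : ∀ a → (∀ j → d j ∣ a j) → R (ψ a)
    ψ-R a d∣a = R-sum (allFin (length ds)) (λ j w → a j * g j w) (λ j → multiple j (d∣a j))
      where
      multiple : ∀ j → d j ∣ a j → R (λ w → a j * g j w)
      multiple j (divides q a≡qd) =
        R-cong (λ w → trans (sym (ℤP.*-assoc q (d j) (g j w))) (cong (_* g j w) (sym a≡qd))) (R-* q (order j))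

    surjective : ∀ y → Σ (ℤ^V m n) λ x → CongMod ds (φ x) y
    surjective y = ψ y , λ j → ∣⇒∣ᵤ (subst (d j ∣_) (sym (trans (cong (_- y j) (φψ y j)) (ℤP.+-inverseʳ (y j))))
                                          (∣-zero (d j)))

    kernel : ∀ x → (CongMod ds (φ x) (λ _ → + 0) ⇔ R x)
    kernel x = mk⇔ to from
      where
      from : R x → CongMod ds (φ x) (λ _ → + 0)
      from Rx j = ∣⇒∣ᵤ (subst (d j ∣_) (sym (ℤP.+-identityʳ (φ x j))) (φ-R Rx j))

      to : CongMod ds (φ x) (λ _ → + 0) → R x
      to φx≡0 = R-cong (λ w → cancel (x w) (ψ a w)) (R-+ Rx-ψa (ψ-R a d∣a))
        where
        a : Elt ds
        a = proj₁ (Spanned-all spans x)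
        Rx-ψa : R (λ w → x w - ψ a w)
        Rx-ψa = proj₂ (Spanned-all spans x)
        cancel : ∀ x p → (x - p) + p ≡ x
        cancel = solve-∀
        -- a_j = φ_j(x) − φ_j(x − ψ a), a difference of two multiples of d_j
        a≡ : ∀ j → (φ x j - + 0) - φ (λ w → x w - ψ a w) j ≡ a j
        a≡ j = trans (cong (_-_ (φ x j - + 0)) (⟪⟫-− x (ψ a) (λ w → img w j)))
                     (trans (difference (φ x j) (φ (ψ a) j)) (φψ a j))
          where
          difference : ∀ f p → (f - + 0) - (f - p) ≡ p
          difference = solve-∀
        d∣a : ∀ j → d j ∣ a j
        d∣a j = subst (d j ∣_) (a≡ j) (∣m∣n⇒∣m-n (∣ᵤ⇒∣ {d j} {φ x j - + 0} (φx≡0 j)) (φ-R Rx-ψa j))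

-- A node is a pair (c , L) of a letter and a list L = x₁ … x_l with
-- l ≤ n′.  It joins the vertex  P L = 0…0 x_l … x₁  to the vertex
-- W (c , L) = 0…0 c x_l … x₁, and its node vector is g (c , L) = e_W − e_P.

module ShiftTree (k n′ : ℕ) where

  m n : ℕ
  m = suc (suc k)
  n = suc n′

  mℤ : ℤ
  mℤ = + m

  -- pad j L = 0…0 x_l … x₁ : the reversal of L = x₁ … x_l, right-justified
  pad : (j : ℕ) → List (Fin m) → Word m j
  pad zero    _        = []
  pad (suc j) []       = zero ∷ pad j []
  pad (suc j) (x ∷ xs) = pad j xs ∷ʳ x

  revList : {j : ℕ} → Word m j → List (Fin m)
  revList []      = []
  revList (b ∷ t) = revList t List.∷ʳ b

  length-revList : {j : ℕ} (t : Word m j) → length (revList t) ≡ j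
  length-revList []      = refl
  length-revList (b ∷ t) = trans (length-∷ʳ (revList t) b) (cong suc (length-revList t))

  revList-∷ʳ : {j : ℕ} (t : Word m j) (a : Fin m) → revList (t ∷ʳ a) ≡ a ∷ revList t
  revList-∷ʳ []      a = refl
  revList-∷ʳ (b ∷ t) a = cong (List._∷ʳ b) (revList-∷ʳ t a)

  pad-short : (j : ℕ) (L : List (Fin m)) → length L ≤ j → pad (suc j) L ≡ zero ∷ pad j L
  pad-short j       []       _         = refl
  pad-short (suc j) (x ∷ xs) (s≤s |xs|≤j) = cong (_∷ʳ x) (pad-short j xs |xs|≤j)

  pad-∷ʳ-zero : (j : ℕ) (L : List (Fin m)) → pad j (L List.∷ʳ zero) ≡ pad j L
  pad-∷ʳ-zero zero    L        = refl
  pad-∷ʳ-zero (suc j) []       = zeros j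
    where
    zeros : (j : ℕ) → pad j [] ∷ʳ zero ≡ zero ∷ pad j []
    zeros zero    = refl
    zeros (suc j) = cong (zero ∷_) (zeros j)
  pad-∷ʳ-zero (suc j) (x ∷ xs) = cong (_∷ʳ x) (pad-∷ʳ-zero j xs)

  pad-exact : (j : ℕ) (L : List (Fin m)) (c : Fin m) → length L ≡ j → pad (suc j) (L List.∷ʳ c) ≡ c ∷ pad j L
  pad-exact _ []       c refl = refl
  pad-exact _ (x ∷ xs) c refl = cong (_∷ʳ x) (pad-exact (length xs) xs c refl)

  pad-revList : {j : ℕ} (u : Word m j) → pad j (revList u) ≡ u
  pad-revList []              = refl
  pad-revList {suc j} (c ∷ u) = trans (pad-exact j (revList u) c (length-revList u)) (cong (c ∷_) (pad-revList u))

  revList-pad : (L : List (Fin m)) → revList (pad (length L) L) ≡ L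
  revList-pad []       = refl
  revList-pad (x ∷ xs) = trans (revList-∷ʳ (pad (length xs) xs) x) (cong (x ∷_) (revList-pad xs))

  Node : Set
  Node = Fin m × List (Fin m)

  _≟N_ : DecidableEquality Node
  _≟N_ = ≡-dec FinP._≟_ (ListP.≡-dec FinP._≟_)

  W : Node → Word m n
  W (c , L) = pad n (L List.∷ʳ c)

  P : List (Fin m) → Word m n
  P L = pad n L

  g : Node → ℤ^V m n
  g (c , L) w = δ (W (c , L)) w - δ (P L) w

  -- a node with c = 0 is degenerate: W (0 , L) = P L
  g-zero : (L : List (Fin m)) (w : Word m n) → g (zero , L) w ≡ + 0
  g-zero L w = trans (cong (λ u → δ u w - δ (P L) w) (pad-∷ʳ-zero n L)) (ℤP.+-inverseʳ (δ (P L) w))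

  module TreeRelations (r : Word m n) where
    open Relations r

    Δ-at : (b : Fin m) (t : Word m n′) (w : Word m n) →
           Δ m n (b ∷ t) w ≡ ΣF m (λ a → δ (t ∷ʳ a) w) - mℤ * δ (b ∷ t) w
    Δ-at b t = Δ-formula m n (b ∷ t)

    -- at full depth: m·g (c , L) = Δ_{0 t} − Δ_{c t} where t = pad n′ L
    R-leaf : (c : Fin m) (L : List (Fin m)) → length L ≡ n′ → R (λ w → mℤ * g (c , L) w)
    R-leaf c L |L|≡n′ = R-cong difference (R-− (R-Δ r (zero ∷ t)) (R-Δ r (c ∷ t)))
      where
      t : Word m n′
      t = pad n′ L
      cancel : ∀ S m a b → (S - m * b) - (S - m * a) ≡ m * (a - b)
      cancel = solve-∀
      difference : ∀ w → Δ m n (zero ∷ t) w - Δ m n (c ∷ t) w ≡ mℤ * g (c , L) w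
      difference w =
        trans (cong₂ _-_ (Δ-at zero t w) (Δ-at c t w))
        (trans (cancel (ΣF m (λ a → δ (t ∷ʳ a) w)) mℤ (δ (c ∷ t) w) (δ (zero ∷ t) w))
               (cong (mℤ *_) (sym (cong₂ (λ u v → δ u w - δ v w) (pad-exact n′ L c |L|≡n′)
                                                                 (pad-short n′ L (ℕP.≤-reflexive |L|≡n′))))))

    -- above full depth: Σ_a g (c , a L) − m·g (c , L) = Δ_{W (c , L)} − Δ_{P L}
    R-inner : (c : Fin m) (L : List (Fin m)) → suc (length L) ≤ n′ →
              R (λ w → ΣF m (λ a → g (c , a ∷ L) w) - mℤ * g (c , L) w)
    R-inner c L |L|<n′ = R-cong difference (R-− (R-Δ r (zero ∷ s)) (R-Δ r (zero ∷ t)))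
      where
      s t : Word m n′
      s = pad n′ (L List.∷ʳ c)
      t = pad n′ L
      W≡ : W (c , L) ≡ zero ∷ s
      W≡ = pad-short n′ (L List.∷ʳ c) (subst (_≤ n′) (sym (length-∷ʳ L c)) |L|<n′)
      P≡ : P L ≡ zero ∷ t
      P≡ = pad-short n′ L (ℕP.≤-trans (ℕP.n≤1+n (length L)) |L|<n′)
      regroup : ∀ S T m a b → (S - m * a) - (T - m * b) ≡ (S - T) - m * (a - b)
      regroup = solve-∀
      difference : ∀ w → Δ m n (zero ∷ s) w - Δ m n (zero ∷ t) w ≡
                         ΣF m (λ a → g (c , a ∷ L) w) - mℤ * g (c , L) w
      difference w =
        trans (cong₂ _-_ (Δ-at zero s w) (Δ-at zero t w))
        (trans (regroup (ΣF m (λ a → δ (s ∷ʳ a) w)) (ΣF m (λ a → δ (t ∷ʳ a) w)) mℤ (δ (zero ∷ s) w) (δ (zero ∷ t) w))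
               (cong₂ _-_ (sym (sum-− (allFin m) (λ a → δ (s ∷ʳ a) w) (λ a → δ (t ∷ʳ a) w)))
                          (cong (mℤ *_) (sym (cong₂ (λ u v → δ u w - δ v w) W≡ P≡)))))

    -- at the root: Σ_c g (c , []) = Δ_{0…0}
    R-root : R (λ w → ΣF m (λ c → g (c , []) w))
    R-root = R-cong root (R-Δ r (zero ∷ pad n′ []))
      where
      root : ∀ w → Δ m n (zero ∷ pad n′ []) w ≡ ΣF m (λ c → g (c , []) w)
      root w = trans (Δ-at zero (pad n′ []) w)
               (trans (cong (_-_ (ΣF m (λ a → δ (pad n′ [] ∷ʳ a) w))) (sym (ΣF-const m (δ (P []) w))))
                      (sym (sum-− (allFin m) (λ c → δ (W (c , [])) w) (λ _ → δ (P []) w))))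

    R-height : (e : ℕ) (c : Fin m) (L : List (Fin m)) → length L ℕ.+ e ≡ n′ →
               R (λ w → + (m ^ suc e) * g (c , L) w)
    R-height zero    c L eq =
      R-cong (λ w → cong (λ z → + z * g (c , L) w) (sym (ℕP.*-identityʳ m)))
             (R-leaf c L (trans (sym (ℕP.+-identityʳ (length L))) eq))
    R-height (suc e) c L eq =
      R-cong telescope
        (R-− (R-sum (allFin m) (λ a w → + (m ^ suc e) * g (c , a ∷ L) w)
                    (λ a → R-height e c (a ∷ L) (trans (sym (ℕP.+-suc (length L) e)) eq)))
             (R-* (+ (m ^ suc e)) (R-inner c L |L|<n′)))
      where
      |L|<n′ : suc (length L) ≤ n′
      |L|<n′ = subst (suc (length L) ≤_) eq
                 (subst (_≤ length L ℕ.+ suc e) (ℕP.+-comm (length L) 1) (ℕP.+-monoʳ-≤ (length L) (s≤s z≤n)))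
      cancel : ∀ p m S G → p * S - p * (S - m * G) ≡ (m * p) * G
      cancel = solve-∀
      telescope : ∀ w → sumL (allFin m) (λ a → + (m ^ suc e) * g (c , a ∷ L) w)
                        - + (m ^ suc e) * (ΣF m (λ a → g (c , a ∷ L) w) - mℤ * g (c , L) w)
                      ≡ + (m ^ suc (suc e)) * g (c , L) w
      telescope w =
        trans (cong (λ z → z - + (m ^ suc e) * (ΣF m (λ a → g (c , a ∷ L) w) - mℤ * g (c , L) w))
                    (sum-*ˡ (allFin m) (+ (m ^ suc e)) (λ a → g (c , a ∷ L) w)))
        (trans (cancel (+ (m ^ suc e)) mℤ (ΣF m (λ a → g (c , a ∷ L) w)) (g (c , L) w))
               (cong (_* g (c , L) w) (sym (ℤP.pos-* m (m ^ suc e)))))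

    R-order : (c : Fin m) (L : List (Fin m)) → length L ≤ n′ → R (λ w → + (m ^ (n ∸ length L)) * g (c , L) w)
    R-order c L |L|≤n′ =
      R-cong (λ w → cong (λ z → + (m ^ z) * g (c , L) w) (sym (ℕP.+-∸-assoc 1 |L|≤n′)))
             (R-height (n′ ∸ length L) c L (ℕP.m+[n∸m]≡n |L|≤n′))

  IsGenerator : Node → Set
  IsGenerator (zero , _)          = ⊥
  IsGenerator (suc _ , zero ∷ _)  = ⊥
  IsGenerator (suc _ , suc _ ∷ _) = ⊤
  IsGenerator (suc zero , [])     = ⊥
  IsGenerator (suc (suc _) , [])  = ⊤

  Generator : Node → Set
  Generator (c , L) = length L ≤ n′ × IsGenerator (c , L)

  -- the order of g (c , L) in ℤ^V / R
  modulus : Node → ℕ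
  modulus (_ , L) = m ^ (n ∸ length L)

  -- On node vectors it is χ,
  -- defined by recursion along the tree so that it is [N ≡ T] on generators
  -- and respects the relations R-inner and R-root; on words it is F, the sum
  -- of χ along the path from 0…0.
  module Dual (T : Node) where

    χ : Fin m → List (Fin m) → ℤ
    χ zero          _           = + 0
    χ (suc c)       (zero ∷ s)  = mℤ * χ (suc c) s - ΣF (suc k) (λ a → 𝟙 ((suc c , suc a ∷ s) ≟N T))
    χ (suc c)       (suc a ∷ s) = 𝟙 ((suc c , suc a ∷ s) ≟N T)
    χ (suc zero)    []          = - ΣF k (λ i → 𝟙 ((suc (suc i) , []) ≟N T))
    χ (suc (suc i)) []          = 𝟙 ((suc (suc i) , []) ≟N T)

    χ-generator : (N : Node) → IsGenerator N → χ (proj₁ N) (proj₂ N) ≡ 𝟙 (N ≟N T)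
    χ-generator (suc (suc i) , [])    _ = refl
    χ-generator (suc c , suc a ∷ s) _ = refl

    -- the relation of R-inner
    χ-inner : (c : Fin m) (s : List (Fin m)) → ΣF m (λ a → χ c (a ∷ s)) ≡ mℤ * χ c s
    χ-inner zero    s = trans (sum-0 (allFin m)) (sym (ℤP.*-zeroʳ mℤ))
    χ-inner (suc c) s = trans (ΣF-suc (suc k) (λ a → χ (suc c) (a ∷ s))) (cancel (mℤ * χ (suc c) s) _)
      where
      cancel : ∀ a b → (a - b) + b ≡ a
      cancel = solve-∀

    -- the relation of R-root
    χ-root : ΣF m (λ c → χ c []) ≡ + 0
    χ-root = trans (ΣF-suc (suc k) (λ c → χ c []))
                   (trans (cong (_+_ (+ 0)) (ΣF-suc k (λ c → χ (suc c) [])))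
                          (cancel (ΣF k (λ i → 𝟙 ((suc (suc i) , []) ≟N T)))))
      where
      cancel : ∀ a → + 0 + (- a + a) ≡ + 0
      cancel = solve-∀

    ℓ : ℕ
    ℓ = length (proj₂ T)

    -- χ c L is divisible by m^{|L| − ℓ}; this bounds the values of F on R
    χ-divisible : (c : Fin m) (L : List (Fin m)) → ℓ ≤ length L → + (m ^ (length L ∸ ℓ)) ∣ χ c L
    χ-divisible-deep : (c : Fin m) (L : List (Fin m)) → ℓ < length L → + (m ^ (length L ∸ ℓ)) ∣ χ c L

    χ-divisible c L ℓ≤|L| with ℓ ℕ.≟ length L
    ... | yes ℓ≡|L| = subst (λ e → + (m ^ e) ∣ χ c L)
                            (sym (trans (cong (length L ∸_) ℓ≡|L|) (ℕP.n∸n≡0 (length L))))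
                            (divides (χ c L) (sym (ℤP.*-identityʳ (χ c L))))
    ... | no ℓ≢|L| = χ-divisible-deep c L (ℕP.≤∧≢⇒< ℓ≤|L| ℓ≢|L|)

    -- below the depth of T every indicator [N ≡ T] vanishes
    χ-divisible-deep zero    L           _ = ∣-zero _
    χ-divisible-deep (suc c) (suc a ∷ s) ℓ<|L| =
      subst (_ ∣_) (sym (𝟙-no (λ N≡T → ℕP.<⇒≢ ℓ<|L| (sym (cong (length ∘ proj₂) N≡T))) _)) (∣-zero _)
    χ-divisible-deep (suc c) (zero ∷ s)  (s≤s ℓ≤|s|) =
      subst₂ _∣_ (trans (sym (ℤP.pos-* m (m ^ (length s ∸ ℓ)))) (cong +_ m^)) χ≡
             (*-monoʳ-∣ mℤ (χ-divisible (suc c) s ℓ≤|s|))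
      where
      m^ : m ℕ.* m ^ (length s ∸ ℓ) ≡ m ^ (suc (length s) ∸ ℓ)
      m^ = cong (m ^_) (sym (ℕP.+-∸-assoc 1 ℓ≤|s|))
      deeper : ∀ a → ¬ (suc c , suc a ∷ s) ≡ T
      deeper a N≡T = ℕP.<⇒≢ (s≤s ℓ≤|s|) (sym (cong (length ∘ proj₂) N≡T))
      χ≡ : mℤ * χ (suc c) s ≡ χ (suc c) (zero ∷ s)
      χ≡ = sym (trans (cong (_-_ (mℤ * χ (suc c) s))
                            (trans (sum-cong (allFin (suc k)) (λ a → 𝟙-no (deeper a) ((suc c , suc a ∷ s) ≟N T)))
                                   (sum-0 (allFin (suc k)))))
                      (ℤP.+-identityʳ (mℤ * χ (suc c) s)))

    -- F v = Σ χ over the tree path from 0…0 to v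
    F : {j : ℕ} → Word m j → ℤ
    F []      = + 0
    F (b ∷ t) = χ b (revList t) + F t

    F⁺ : {j : ℕ} → Fin m → Word m j → ℤ
    F⁺ a []      = + 0
    F⁺ a (b ∷ t) = χ b (a ∷ revList t) + F⁺ a t

    F-∷ʳ : {j : ℕ} (u : Word m j) (a : Fin m) → F (u ∷ʳ a) ≡ F⁺ a u + χ a []
    F-∷ʳ []      a = trans (ℤP.+-identityʳ (χ a [])) (sym (ℤP.+-identityˡ (χ a [])))
    F-∷ʳ (b ∷ t) a = trans (cong₂ _+_ (cong (χ b) (revList-∷ʳ t a)) (F-∷ʳ t a))
                           (sym (ℤP.+-assoc (χ b (a ∷ revList t)) (F⁺ a t) (χ a [])))

    -- summing over the appended letter is the inner relation of χ, letter by letter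
    ΣF⁺ : {j : ℕ} (u : Word m j) → ΣF m (λ a → F⁺ a u) ≡ mℤ * F u
    ΣF⁺ []      = trans (sum-0 (allFin m)) (sym (ℤP.*-zeroʳ mℤ))
    ΣF⁺ (b ∷ t) = trans (sum-+ (allFin m) (λ a → χ b (a ∷ revList t)) (λ a → F⁺ a t))
                        (trans (cong₂ _+_ (χ-inner b (revList t)) (ΣF⁺ t))
                               (sym (ℤP.*-distribˡ-+ mℤ (χ b (revList t)) (F t))))

    F-Δ : (b : Fin m) (t : Word m n′) → ΣF m (λ a → F (t ∷ʳ a)) - mℤ * F (b ∷ t) ≡ - (mℤ * χ b (revList t))
    F-Δ b t =
      begin
        ΣF m (λ a → F (t ∷ʳ a)) - mℤ * F (b ∷ t)
      ≡⟨ cong (_- mℤ * F (b ∷ t)) (sum-cong (allFin m) (F-∷ʳ t)) ⟩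
        ΣF m (λ a → F⁺ a t + χ a []) - mℤ * F (b ∷ t)
      ≡⟨ cong (_- mℤ * F (b ∷ t)) (trans (sum-+ (allFin m) (λ a → F⁺ a t) (λ a → χ a []))
                                          (cong₂ _+_ (ΣF⁺ t) χ-root)) ⟩
        (mℤ * F t + + 0) - mℤ * (χ b (revList t) + F t)
      ≡⟨ cancel mℤ (χ b (revList t)) (F t) ⟩
        - (mℤ * χ b (revList t))
      ∎
      where
      open ≡-Reasoning
      cancel : ∀ m x f → (m * f + + 0) - m * (x + f) ≡ - (m * x)
      cancel = solve-∀

    F-pad : (j : ℕ) (L : List (Fin m)) → length L ≤ j → F (pad j L) ≡ F (pad (length L) L)
    F-pad j L |L|≤j with ℕP.m≤n⇒m<n∨m≡n |L|≤j
    ... | inj₂ refl = refl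
    F-pad (suc j) L _ | inj₁ (s≤s |L|≤j) =
      trans (cong F (pad-short j L |L|≤j)) (trans (ℤP.+-identityˡ (F (pad j L))) (F-pad j L |L|≤j))

    F-node : (c : Fin m) (L : List (Fin m)) → length L ≤ n′ → F (W (c , L)) - F (P L) ≡ χ c L
    F-node c L |L|≤n′ =
      begin
        F (pad n (L List.∷ʳ c)) - F (pad n L)
      ≡⟨ cong₂ _-_ (F-pad n (L List.∷ʳ c) (subst (_≤ n) (sym (length-∷ʳ L c)) (s≤s |L|≤n′)))
                   (F-pad n L (ℕP.m≤n⇒m≤1+n |L|≤n′)) ⟩
        F (pad (length (L List.∷ʳ c)) (L List.∷ʳ c)) - F (pad (length L) L)
      ≡⟨ cong (_- F (pad (length L) L)) (F-pad-exact (length-∷ʳ L c)) ⟩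
        (χ c (revList (pad (length L) L)) + F (pad (length L) L)) - F (pad (length L) L)
      ≡⟨ cong (λ L′ → (χ c L′ + F (pad (length L) L)) - F (pad (length L) L)) (revList-pad L) ⟩
        (χ c L + F (pad (length L) L)) - F (pad (length L) L)
      ≡⟨ cancel (χ c L) (F (pad (length L) L)) ⟩
        χ c L
      ∎
      where
      open ≡-Reasoning
      F-pad-exact : ∀ {j} → j ≡ suc (length L) → F (pad j (L List.∷ʳ c)) ≡ F (c ∷ pad (length L) L)
      F-pad-exact refl = cong F (pad-exact (length L) L c refl)
      cancel : ∀ a b → (a + b) - b ≡ a
      cancel = solve-∀

    F-Δ-divisible : (b : Fin m) (t : Word m n′) → ℓ ≤ n′ → + modulus T ∣ - (mℤ * χ b (revList t))
    F-Δ-divisible b t ℓ≤n′ = ∣m⇒∣-m (subst₂ _∣_ m^ refl (*-monoʳ-∣ mℤ χ-div))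
      where
      χ-div : + (m ^ (n′ ∸ ℓ)) ∣ χ b (revList t)
      χ-div = subst (λ j → + (m ^ (j ∸ ℓ)) ∣ χ b (revList t)) (length-revList t)
                    (χ-divisible b (revList t) (subst (ℓ ≤_) (sym (length-revList t)) ℓ≤n′))
      m^ : mℤ * + (m ^ (n′ ∸ ℓ)) ≡ + modulus T
      m^ = trans (sym (ℤP.pos-* m (m ^ (n′ ∸ ℓ)))) (cong (λ e → + (m ^ e)) (sym (ℕP.+-∸-assoc 1 ℓ≤n′)))

  -- The list of generating nodes, ordered as in deBruijnModuli: first the k
  -- roots (c , []) with c ≥ 2, then for each k′ < n′ the level of the nodes
  -- (c , a ∷ s) with c, a ≥ 1 and |s| = n′ − (k′ + 1).
  rootNode : Fin k → Node
  rootNode i = (suc (suc i) , [])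

  branchNode : {l : ℕ} → Fin (suc k) → Fin (suc k) × Word m l → Node
  branchNode c (a , s) = (suc c , suc a ∷ Vec.toList s)

  roots : List Node
  roots = map rootNode (allFin k)

  pairs : (k′ : ℕ) → List (Fin (suc k) × Word m (n′ ∸ suc k′))
  pairs k′ = cartesianProductWith _,_ (allFin (suc k)) (allWords m (n′ ∸ suc k′))

  level : ℕ → List Node
  level k′ = cartesianProductWith branchNode (allFin (suc k)) (pairs k′)

  generators : List Node
  generators = roots ++ concatMap level (upTo n′)

  level-∈ : {k′ : ℕ} {N : Node} → N ∈ level k′ → IsGenerator N × length (proj₂ N) ≡ suc (n′ ∸ suc k′)
  level-∈ {k′} N∈ with ∈-cartesianProductWith⁻ branchNode (allFin (suc k)) (pairs k′) N∈
  ... | c , (a , s) , _ , _ , refl = tt , cong suc (VecP.length-toList s)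

  depth-bound : {k′ : ℕ} → k′ < n′ → suc (n′ ∸ suc k′) ≤ n′
  depth-bound {k′} k′<n′ = subst (_≤ n′) (ℕP.+-∸-assoc 1 k′<n′) (ℕP.m∸n≤m n′ k′)

  generators-generate : {N : Node} → N ∈ generators → Generator N
  generators-generate N∈ with ∈-++⁻ roots N∈
  ... | inj₁ N∈roots with ∈-map⁻ rootNode N∈roots
  ...   | _ , _ , refl = z≤n , tt
  generators-generate N∈ | inj₂ N∈rest with find (∈-concatMap⁻ level N∈rest)
  ... | k′ , k′∈ , N∈level with level-∈ N∈level
  ...   | isGen , |L|≡ = subst (_≤ n′) (sym |L|≡) (depth-bound (∈-upTo⁻ k′∈)) , isGen

  generators-complete : (N : Node) → Generator N → N ∈ generators
  generators-complete (suc (suc i) , [])  _ = ∈-++⁺ˡ (∈-map⁺ rootNode (∈-allFin i))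
  generators-complete (suc c , suc a ∷ s) (|L|≤n′ , _) =
    ∈-++⁺ʳ roots (∈-concatMap⁺ level (lose (∈-upTo⁺ k′<n′) N∈level))
    where
    k′ : ℕ
    k′ = n′ ∸ length (suc a ∷ s)
    k′<n′ : k′ < n′
    k′<n′ = subst (_≤ n′) (ℕP.+-∸-assoc 1 |L|≤n′) (ℕP.m∸n≤m n′ (length s))
    |s|≡ : length s ≡ n′ ∸ suc k′
    |s|≡ = sym (trans (cong (n′ ∸_) (sym (ℕP.+-∸-assoc 1 |L|≤n′)))
                      (ℕP.m∸[m∸n]≡n (ℕP.≤-trans (ℕP.n≤1+n (length s)) |L|≤n′)))
    asWord : (l : ℕ) → length s ≡ l → Σ (Word m l) λ v → Vec.toList v ≡ s
    asWord _ refl = Vec.fromList s , VecP.toList∘fromList s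
    v : Word m (n′ ∸ suc k′)
    v = proj₁ (asWord (n′ ∸ suc k′) |s|≡)
    N∈level : (suc c , suc a ∷ s) ∈ level k′
    N∈level = subst (_∈ level k′) (cong (λ L → (suc c , suc a ∷ L)) (proj₂ (asWord (n′ ∸ suc k′) |s|≡)))
                    (∈-cartesianProductWith⁺ branchNode (∈-allFin c)
                      (∈-cartesianProductWith⁺ _,_ (∈-allFin a) (∈-allWords m v)))

  generators-unique : Unique generators
  generators-unique =
    UniqueP.++⁺ roots-unique (concatMap-unique level (UniqueP.upTo⁺ n′) level-unique same-level) disjoint
    where
    roots-unique : Unique roots
    roots-unique = UniqueP.map⁺ (λ e → FinP.suc-injective (FinP.suc-injective (cong proj₁ e))) (UniqueP.allFin⁺ k)
    branchNode-injective : ∀ {l} {c c′} {p p′ : Fin (suc k) × Word m l} →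
                           branchNode c p ≡ branchNode c′ p′ → c ≡ c′ × p ≡ p′
    branchNode-injective {p = a , s} {a′ , s′} e =
      FinP.suc-injective (cong proj₁ e) ,
      cong₂ _,_ (FinP.suc-injective (ListP.∷-injectiveˡ (cong proj₂ e)))
                (trans (sym (VecP.cast-is-id refl s)) (VecP.toList-injective refl s s′ (ListP.∷-injectiveʳ (cong proj₂ e))))
    level-unique : ∀ k′ → Unique (level k′)
    level-unique k′ = UniqueP.cartesianProductWith⁺ branchNode branchNode-injective (UniqueP.allFin⁺ (suc k))
                        (UniqueP.cartesianProductWith⁺ _,_ ,-injective (UniqueP.allFin⁺ (suc k)) (allWords-unique m _))
    -- nodes on different levels have different depths
    same-level : ∀ {k′ k″ N} → k′ ∈ upTo n′ → k″ ∈ upTo n′ → N ∈ level k′ → N ∈ level k″ → k′ ≡ k″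
    same-level k′∈ k″∈ N∈k′ N∈k″ =
      ℕP.suc-injective (ℕP.∸-cancelˡ-≡ (∈-upTo⁻ k′∈) (∈-upTo⁻ k″∈)
        (ℕP.suc-injective (trans (sym (proj₂ (level-∈ N∈k′))) (proj₂ (level-∈ N∈k″)))))
    disjoint : ∀ {N} → ¬ (N ∈ roots × N ∈ concatMap level (upTo n′))
    disjoint (N∈roots , N∈rest) with ∈-map⁻ rootNode N∈roots | find (∈-concatMap⁻ level {xs = upTo n′} N∈rest)
    ... | _ , _ , refl | _ , _ , N∈level with proj₂ (level-∈ N∈level)
    ... | ()

  generators-moduli : map modulus generators ≡ deBruijnModuli m n
  generators-moduli = trans (ListP.map-++ modulus roots (concatMap level (upTo n′)))
                            (cong₂ _++_ roots-moduli levels-moduli)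
    where
    roots-moduli : map modulus roots ≡ List.replicate k (m ^ n)
    roots-moduli = trans (sym (ListP.map-∘ (allFin k)))
                         (trans (map-constant (modulus ∘ rootNode) (All.tabulate (λ _ → refl)))
                                (cong (λ l → List.replicate l (m ^ n)) (length-allFin k)))
    level-moduli : ∀ {k′} → k′ < n′ → map modulus (level k′) ≡
                   List.replicate (m ^ (n′ ∸ suc k′) ℕ.* (suc k ^ 2)) (m ^ suc k′)
    level-moduli {k′} k′<n′ =
      trans (map-constant modulus (All.tabulate (λ N∈ → trans (cong (λ d → m ^ (n ∸ d)) (proj₂ (level-∈ N∈)))
                                                              (cong (m ^_) (ℕP.m∸[m∸n]≡n k′<n′)))))
            (cong (λ l → List.replicate l (m ^ suc k′)) size)
      where
      size : length (level k′) ≡ m ^ (n′ ∸ suc k′) ℕ.* (suc k ^ 2)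
      size = trans (length-cartesianProductWith branchNode (allFin (suc k)) (pairs k′))
             (trans (cong₂ ℕ._*_ (length-allFin (suc k))
                      (trans (length-cartesianProductWith _,_ (allFin (suc k)) (allWords m (n′ ∸ suc k′)))
                             (cong₂ ℕ._*_ (length-allFin (suc k)) (length-allWords m (n′ ∸ suc k′)))))
                    (square (suc k) (m ^ (n′ ∸ suc k′))))
        where
        square : ∀ a x → a ℕ.* (a ℕ.* x) ≡ x ℕ.* (a ℕ.* (a ℕ.* 1))
        square = ℕRing.solve-∀
    levels-moduli : map modulus (concatMap level (upTo n′)) ≡
                    concatMap (λ k′ → List.replicate (m ^ (n′ ∸ suc k′) ℕ.* (suc k ^ 2)) (m ^ suc k′)) (upTo n′)
    levels-moduli = trans (ListP.map-concatMap modulus level (upTo n′))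
                          (cong List.concat (ListP.map-cong-local (All.tabulate (λ k′∈ → level-moduli (∈-upTo⁻ k′∈)))))

  module Decomposition (r : Word m n) where
    open Relations r
    open TreeRelations r

    ds : List ℕ
    ds = map modulus generators

    T : Fin (length ds) → Node
    T = at modulus generators

    T-generator : (j : Fin (length ds)) → Generator (T j)
    T-generator j = generators-generate (at-∈ modulus generators j)

    open Presentation r ds (λ j → g (T j))

    -- the functional dual to g (T i), normalised to vanish at r
    img : Word m n → Elt ds
    img w i = Dual.F (T i) w - Dual.F (T i) r

    pairing-node : (i : Fin (length ds)) (c : Fin m) (L : List (Fin m)) → length L ≤ n′ →
                   ⟪ g (c , L) ∣ (λ w → img w i) ⟫ ≡ Dual.χ (T i) c L
    pairing-node i c L |L|≤n′ =
      trans (⟪⟫-− (δ (W (c , L))) (δ (P L)) (λ w → img w i))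
      (trans (cong₂ _-_ (⟪⟫-δ (W (c , L)) (λ w → img w i)) (⟪⟫-δ (P L) (λ w → img w i)))
      (trans (cancel (Dual.F (T i) (W (c , L))) (Dual.F (T i) (P L)) (Dual.F (T i) r))
             (Dual.F-node (T i) c L |L|≤n′)))
      where
      cancel : ∀ a b c → (a - c) - (b - c) ≡ a - b
      cancel = solve-∀

    dual : ∀ i j → ⟪ g (T j) ∣ (λ w → img w i) ⟫ ≡ 𝟙 (j Fin.≟ i)
    dual i j =
      trans (pairing-node i (proj₁ (T j)) (proj₂ (T j)) (proj₁ (T-generator j)))
      (trans (Dual.χ-generator (T i) (T j) (proj₂ (T-generator j))) (same-indicator (j Fin.≟ i)))
      where
      same-indicator : (j≟i : Dec (j ≡ i)) → 𝟙 (T j ≟N T i) ≡ 𝟙 j≟i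
      same-indicator (yes refl) = 𝟙-yes refl (T j ≟N T j)
      same-indicator (no j≢i)   = 𝟙-no (j≢i ∘ at-injective modulus generators-unique j i) (T j ≟N T i)

    order : ∀ j → R (λ w → d j * g (T j) w)
    order j = subst (λ e → R (λ w → + e * g (T j) w)) (sym (lookup-map-at modulus generators j))
                    (R-order (proj₁ (T j)) (proj₂ (T j)) (proj₁ (T-generator j)))

    kills : ∀ v i → d i ∣ ⟪ gen m n r v ∣ (λ w → img w i) ⟫
    kills v i with VecP.≡-dec FinP._≟_ v r
    ... | yes refl = subst (d i ∣_) (sym (trans (⟪⟫-δ r (λ w → img w i)) (ℤP.+-inverseʳ (Dual.F (T i) r))))
                           (∣-zero (d i))
    kills (b ∷ t) i | no _ =
      subst (d i ∣_) (sym Δ-value)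
            (subst (λ e → + e ∣ - (mℤ * Dual.χ (T i) b (revList t))) (sym (lookup-map-at modulus generators i))
                   (Dual.F-Δ-divisible (T i) b t (proj₁ (T-generator i))))
      where
      F : {j : ℕ} → Word m j → ℤ
      F = Dual.F (T i)
      cancel : ∀ S m f c → (S - m * c) - m * (f - c) ≡ S - m * f
      cancel = solve-∀
      Δ-value : ⟪ Δ m n (b ∷ t) ∣ (λ w → img w i) ⟫ ≡ - (mℤ * Dual.χ (T i) b (revList t))
      Δ-value =
        trans (Δ-pairing m n (b ∷ t) (λ w → img w i))
        (trans (cong (_- mℤ * img (b ∷ t) i)
                     (trans (sum-− (allFin m) (λ a → F (t ∷ʳ a)) (λ _ → F r))
                            (cong (_-_ (ΣF m (λ a → F (t ∷ʳ a)))) (ΣF-const m (F r)))))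
        (trans (cancel (ΣF m (λ a → F (t ∷ʳ a))) mℤ (F (b ∷ t)) (F r))
               (Dual.F-Δ (T i) b t)))

    Spanned-generator : (N : Node) → Generator N → Spanned (g N)
    Spanned-generator N gen-N with at-index modulus (generators-complete N gen-N)
    ... | j , T≡N = subst (Spanned ∘ g) T≡N (Spanned-g j)

    Spanned-node : (c : Fin m) (L : List (Fin m)) → length L ≤ n′ → Spanned (g (c , L))
    Spanned-node zero           L          _      = Spanned-cong (λ w → sym (g-zero L w)) (Spanned-R R-0)
    Spanned-node (suc c)        (suc a ∷ s) |L|≤n′ = Spanned-generator (suc c , suc a ∷ s) (|L|≤n′ , tt)
    Spanned-node (suc c)        (zero ∷ s)  |L|≤n′ =
      -- g (c , 0 s) = (m·g (c , s) − Σ_{a ≥ 1} g (c , a s)) + (Σ_a g (c , a s) − m·g (c , s))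
      Spanned-cong regroup
        (Spanned-+ {λ w → mℤ * g (suc c , s) w - ΣF (suc k) (λ a → g (suc c , suc a ∷ s) w)}
           (Spanned-− {λ w → mℤ * g (suc c , s) w}
              (Spanned-* mℤ {g (suc c , s)} (Spanned-node (suc c) s (ℕP.≤-trans (ℕP.n≤1+n (length s)) |L|≤n′)))
              (Spanned-sum (allFin (suc k)) (λ a → g (suc c , suc a ∷ s))
                           (λ a → Spanned-generator (suc c , suc a ∷ s) (|L|≤n′ , tt))))
           (Spanned-R (R-inner (suc c) s |L|≤n′)))
      where
      cancel : ∀ M G₀ S → (M - S) + ((G₀ + S) - M) ≡ G₀
      cancel = solve-∀
      regroup : ∀ w → (mℤ * g (suc c , s) w - ΣF (suc k) (λ a → g (suc c , suc a ∷ s) w))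
                      + (ΣF m (λ a → g (suc c , a ∷ s) w) - mℤ * g (suc c , s) w)
                    ≡ g (suc c , zero ∷ s) w
      regroup w =
        trans (cong (λ S → (mℤ * g (suc c , s) w - ΣF (suc k) (λ a → g (suc c , suc a ∷ s) w))
                           + (S - mℤ * g (suc c , s) w))
                    (ΣF-suc (suc k) (λ a → g (suc c , a ∷ s) w)))
              (cancel (mℤ * g (suc c , s) w) (g (suc c , zero ∷ s) w) (ΣF (suc k) (λ a → g (suc c , suc a ∷ s) w)))
    Spanned-node (suc zero)     []          _      =
      -- g (1 , []) = Σ_c g (c , []) − g (0 , []) − Σ_{c ≥ 2} g (c , [])
      Spanned-cong regroup
        (Spanned-− {λ w → ΣF m (λ c → g (c , []) w) - g (zero , []) w}
           (Spanned-− {λ w → ΣF m (λ c → g (c , []) w)} {g (zero , [])} (Spanned-R R-root) (Spanned-node zero [] z≤n))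
           (Spanned-sum (allFin k) (λ i → g (suc (suc i) , []))
                        (λ i → Spanned-generator (suc (suc i) , []) (z≤n , tt))))
      where
      cancel : ∀ a b c → (a + (b + c)) - a - c ≡ b
      cancel = solve-∀
      regroup : ∀ w → (ΣF m (λ c → g (c , []) w) - g (zero , []) w) - ΣF k (λ i → g (suc (suc i) , []) w)
                    ≡ g (suc zero , []) w
      regroup w =
        trans (cong (λ S → (S - g (zero , []) w) - ΣF k (λ i → g (suc (suc i) , []) w))
                    (trans (ΣF-suc (suc k) (λ c → g (c , []) w))
                           (cong (_+_ (g (zero , []) w)) (ΣF-suc k (λ c → g (suc c , []) w)))))
              (cancel (g (zero , []) w) (g (suc zero , []) w) (ΣF k (λ i → g (suc (suc i) , []) w)))
    Spanned-node (suc (suc i)) []          |L|≤n′ = Spanned-generator (suc (suc i) , []) (|L|≤n′ , tt)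

    -- e_u − e_{0…0} for u = pad n (revList t), telescoped along the tree path from 0…0 to u
    Spanned-path : {j : ℕ} (t : Word m j) → j ≤ n → Spanned (λ w → δ (pad n (revList t)) w - δ (P []) w)
    Spanned-path []      _          = Spanned-cong (λ w → sym (ℤP.+-inverseʳ (δ (P []) w))) (Spanned-R R-0)
    Spanned-path (c ∷ t) (s≤s j≤n′) =
      Spanned-cong (λ w → telescope (δ (W (c , revList t)) w) (δ (P (revList t)) w) (δ (P []) w))
        (Spanned-+ {g (c , revList t)} {λ w → δ (pad n (revList t)) w - δ (P []) w}
                   (Spanned-node c (revList t) (subst (_≤ n′) (sym (length-revList t)) j≤n′))
                   (Spanned-path t (ℕP.m≤n⇒m≤1+n j≤n′)))
      where
      telescope : ∀ a b z → (a - b) + (b - z) ≡ a - z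
      telescope = solve-∀

    spans : ∀ v → Spanned (δ v)
    spans v =
      Spanned-cong (λ w → trans (cong₂ (λ u u′ → ((δ u w - δ (P []) w) - (δ u′ w - δ (P []) w)) + δ r w)
                                       (pad-revList v) (pad-revList r))
                                (cancel (δ v w) (δ r w) (δ (P []) w)))
        (Spanned-+ {λ w → (δ (pad n (revList v)) w - δ (P []) w) - (δ (pad n (revList r)) w - δ (P []) w)}
           (Spanned-− {λ w → δ (pad n (revList v)) w - δ (P []) w} {λ w → δ (pad n (revList r)) w - δ (P []) w}
                      (Spanned-path v ℕP.≤-refl) (Spanned-path r ℕP.≤-refl))
           (Spanned-R R-r))
      where
      cancel : ∀ a b z → ((a - z) - (b - z)) + b ≡ a
      cancel = solve-∀

    decomposition : CriticalGroupIso m n r ds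
    decomposition = recognise img dual order kills spans

theorem5p1 : (m n : ℕ) → 2 ≤ m → 1 ≤ n →
    (r : Word m n) → CriticalGroupIso m n r (deBruijnModuli m n)
theorem5p1 (suc (suc k)) (suc n′) (s≤s (s≤s _)) (s≤s _) r =
  subst (CriticalGroupIso (suc (suc k)) (suc n′) r) (ShiftTree.generators-moduli k n′)
        (ShiftTree.Decomposition.decomposition k n′ r)
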